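{- Let $w\in S_n$ be a Boolean permutation with reduced decomposition $w=s_{j_1}\cdots s_{j_l}$ ($j_1,\dots,j_l$ pairwise distinct). Then $\widetilde w\in S_{2n}$ is tight; more precisely, for the reduced word $\widetilde{\mathbf w}$ of $\widetilde w$ and every non-full mask $\underline x$ one has $|\mathcal E^0(\underline x)|>|\mathcal D^0(\underline x)|$.
   Context: $S_m$ symmetric group, $s_i=(i,i+1)$, $\alpha_i$ simple roots of type $A$; for $y\in S_m$, $y(e_a-e_b)=e_{y(a)}-e_{y(b)}$, positive iff $y(a)<y(b)$. Boolean permutation: product of distinct simple reflections. Doubling map $\widetilde x(2i)=2x(i)$, $\widetilde x(2i-1)=2x(i)-1$. The word $\widetilde{\mathbf w}$ is the concatenation over $i=1,\dots,l$ of the blocks $s_{2j_i}\,s_{2j_i-1}\,s_{2j_i+1}\,s_{2j_i}$ (a reduced word of length $4l$ for $\widetilde w$). For a reduced word $\mathbf v=\mathbf s_{k_1}\cdots\mathbf s_{k_L}$, a mask is $\underline x\in\{0,1\}^L$; it is full if all entries are $1$. $\pi_p(\underline x)$ is the product in order of $s_{k_r}$, $r\le p$, $\underline x_r=1$. The defect set is $\mathcal D(\underline x)=\{p:\pi_{p-1}(\underline x)\alpha_{k_p}<0\}$; $\mathcal D^0(\underline x)=\{p\in\mathcal D(\underline x):\underline x_p=0\}$, $\mathcal E^0(\underline x)=\{p\notin\mathcal D(\underline x):\underline x_p=0\}$. An element $v$ of a Weyl group is tight if it has a reduced word for which every non-full mask satisfies $|\mathcal E^0(\underline x)|>|\mathcal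 D^0(\underline x)|$ (equivalently, by Deodhar, $P_{u,v}=\sum_{\underline x:\pi(\underline x)=u}q^{|\mathcal D(\underline x)|}$ for all $u$). -}

module Defs where

open import Data.Nat using (ℕ; zero; suc; _+_; _*_; _∸_; _<_; _≤_; _<ᵇ_; _≡ᵇ_)
open import Data.Nat.DivMod using (_/_; _%_)
open import Data.Bool using (Bool; true; false; if_then_else_; _∧_; not)
open import Data.List using (List; []; _∷_; length; concatMap; upTo; filter; map; _++_)
open import Data.Product using (Σ; _×_; _,_)
open import Data.List.Relation.Unary.All using (All)
open import Data.Vec using (Vec; toList; replicate)
open import Relation.Binary.PropositionalEquality using (_≡_)
open import Relation.Nullary using (¬_)

-- Permutations of {1,…,m} are represented as functions ℕ → ℕ
-- (acting as the identity outside {1,…,m}).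

s : ℕ → ℕ → ℕ
s i a = if a ≡ᵇ i then suc i else (if a ≡ᵇ suc i then i else a)

prod : List ℕ → ℕ → ℕ
prod []       a = a
prod (k ∷ ks) a = s k (prod ks a)

-- number of inversions of v ∈ S_m: pairs 1 ≤ a < b ≤ m with v a > v b (= Coxeter length)
inversions : ℕ → (ℕ → ℕ) → ℕ
inversions m v =
  length (filter (λ p → Data.Nat._<?_ (v (Data.Product.proj₂ p)) (v (Data.Product.proj₁ p)))
    (concatMap (λ a → map (λ b → (suc a , suc b)) (filter (λ b → Data.Nat._<?_ a b) (upTo m))) (upTo m)))

-- At position p with current prefix product
-- y = π_{p-1}(x), y(α_{k_p}) = e_{y(k_p)} - e_{y(k_p+1)} is negative iff y(k_p+1) < y(k_p).
defectFlags : (ℕ → ℕ) → List ℕ → List Bool → List Bool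
defectFlags y (k ∷ ks) (b ∷ bs) =
  (y (suc k) <ᵇ y k) ∷ defectFlags (if b then (λ a → y (s k a)) else y) ks bs
defectFlags y _ _ = []

countPairs : (Bool → Bool → Bool) → List Bool → List Bool → ℕ
countPairs f (x ∷ xs) (d ∷ ds) = (if f x d then 1 else 0) + countPairs f xs ds
countPairs f _ _ = 0

D0 : (word : List ℕ) → Vec Bool (length word) → ℕ
D0 word x = countPairs (λ b d → not b ∧ d) (toList x) (defectFlags (λ a → a) word (toList x))

E0 : (word : List ℕ) → Vec Bool (length word) → ℕ
E0 word x = countPairs (λ b d → not b ∧ not d) (toList x) (defectFlags (λ a → a) word (toList x))

NonFull : ∀ {L} → Vec Bool L → Set
NonFull x = ¬ (x ≡ replicate _ true)

IsWordIn : ℕ → List ℕ → Set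
IsWordIn m word = All (λ k → 1 ≤ k × k < m) word

IsReducedWordFor : ℕ → List ℕ → (ℕ → ℕ) → Set
IsReducedWordFor m word v =
  IsWordIn m word × (∀ a → prod word a ≡ v a) × (length word ≡ inversions m (prod word))

Tight : ℕ → (ℕ → ℕ) → Set
Tight m v = Σ (List ℕ) λ word → Σ (IsReducedWordFor m word v) λ _ →
  (x : Vec Bool (length word)) → NonFull x → D0 word x < E0 word x

-- doubling map: x̃(2i) = 2x(i), x̃(2i-1) = 2x(i) - 1
double : (ℕ → ℕ) → ℕ → ℕ
double x a = if a % 2 ≡ᵇ 0 then 2 * x (a / 2) else 2 * x ((a + 1) / 2) ∸ 1

doubledWord : List ℕ → List ℕ
doubledWord = concatMap (λ j → 2 * j ∷ 2 * j ∸ 1 ∷ suc (2 * j) ∷ 2 * j ∷ [])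

{-# OPTIONS --safe #-}
module Submission where

-- The block s_{2j} s_{2j-1} s_{2j+1} s_{2j} only moves the
-- positions 2j-1 .. 2j+2, that is the pairs {2j-1, 2j} and {2j+1, 2j+2}, and until it is read the
-- prefix product maps {1 .. 2j} onto itself, because no other block contains the letter s_{2j}.
-- Hence the defects met inside the block, and whether its two pairs are inverted after it, only
-- depend on the mask bits and on whether the two pairs were inverted before it; this is a finite
-- check.  A block can meet more defects than skipped non-defects only by using up inversions
-- left in its pairs by a neighbouring block read earlier.  Weighting an inversion of pair i by
-- n - i while block i is unread and by i while block i - 1 is unread, each block pays for the
-- inversions it leaves behind and still gains 1 when its mask is not full, so summing over the
-- blocks gives n |D⁰| + #{blocks not fully kept} ≤ n |E⁰|.  The full mask meets no defect, so
-- every letter raises the inversion number by one and the word is reduced; it spells the doubled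
-- permutation because each block spells the doubled simple reflection.

open import Defs
open import Data.Bool using (Bool; true; false; if_then_else_; not; _∧_; T)
open import Data.Bool.ListAction using (and)
open import Data.Bool.Properties using (T-∧)
open import Data.Empty using (⊥-elim)
open import Data.List using (List; []; _∷_; _++_; length; map; filter; concatMap; applyUpTo; upTo; replicate)
open import Data.List.Properties
  using (map-++; map-∘; map-cong; map-cong-local; map-id; map-id-local; length-++;
         filter-++; filter-all; filter-none)
open import Data.List.Relation.Unary.All as All using (All; []; _∷_)
import Data.List.Relation.Unary.All.Properties as All
open import Data.List.Relation.Unary.AllPairs using ([]; _∷_)
open import Data.List.Relation.Unary.Unique.Propositional using (Unique)
open import Data.Nat
open import Data.Nat.DivMod using (_%_; _/_; m*n%n≡0; m*n/n≡m; [m+kn]%n≡m%n)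
open import Data.Nat.ListAction using (sum)
open import Data.Nat.Properties
open import Algebra.Properties.CommutativeSemigroup +-commutativeSemigroup using (x∙yz≈y∙xz)
open import Data.Nat.Solver using (module +-*-Solver)
open import Data.Product using (Σ; _×_; _,_; proj₁; proj₂)
open import Data.Unit using (tt)
open import Data.Vec using (Vec; toList; []; _∷_)
open import Function using (_∘_; case_of_)
open import Function.Bundles using (Equivalence)
open import Relation.Binary.Definitions using (tri<; tri≈; tri>)
open import Relation.Binary.PropositionalEquality
open import Relation.Nullary using (Dec; yes; no; does)
open import Relation.Nullary.Decidable using (dec-true; dec-false)

s-at : ∀ k → s k k ≡ suc k
s-at k rewrite dec-true (k ≟ k) refl = refl

s-at-suc : ∀ k → s k (suc k) ≡ k
s-at-suc k rewrite dec-false (suc k ≟ k) 1+n≢n | dec-true (suc k ≟ suc k) refl = refl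

s-fix : ∀ {k a} → a ≢ k → a ≢ suc k → s k a ≡ a
s-fix {k} {a} a≢k a≢1+k rewrite dec-false (a ≟ k) a≢k | dec-false (a ≟ suc k) a≢1+k = refl

s-fix-< : ∀ {k a} → a < k → s k a ≡ a
s-fix-< a<k = s-fix (<⇒≢ a<k) (<⇒≢ (m<n⇒m<1+n a<k))

s-fix-> : ∀ {k a} → suc k < a → s k a ≡ a
s-fix-> 1+k<a = s-fix (>⇒≢ (<-trans (n<1+n _) 1+k<a)) (>⇒≢ 1+k<a)

s-involutive : ∀ k a → s k (s k a) ≡ a
s-involutive k a with a ≟ k
... | yes refl = trans (cong (s a) (s-at a)) (s-at-suc a)
... | no a≢k with a ≟ suc k
...   | yes refl = trans (cong (s k) (s-at-suc k)) (s-at k)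
...   | no a≢1+k = trans (cong (s k) (s-fix a≢k a≢1+k)) (s-fix a≢k a≢1+k)

s-suc : ∀ k a → s (suc k) (suc a) ≡ suc (s k a)
s-suc k a with a ≡ᵇ k | a ≡ᵇ suc k
... | true  | _     = refl
... | false | true  = refl
... | false | false = refl

s-shift : ∀ P k a → s (k + P) (a + P) ≡ s k a + P
s-shift P k a rewrite +-comm k P | +-comm a P | +-comm (s k a) P = shiftˡ P
  where
  shiftˡ : ∀ P → s (P + k) (P + a) ≡ P + s k a
  shiftˡ zero    = refl
  shiftˡ (suc P) = trans (s-suc (P + k) (P + a)) (cong suc (shiftˡ P))

s-preserves-≤ : ∀ {k c a} → k ≢ c → a ≤ c → s k a ≤ c
s-preserves-≤ {k} {c} {a} k≢c a≤c with a ≟ k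
... | yes refl = subst (_≤ c) (sym (s-at a)) (≤∧≢⇒< a≤c k≢c)
... | no a≢k with a ≟ suc k
...   | yes refl = subst (_≤ c) (sym (s-at-suc k)) (≤-trans (n≤1+n k) a≤c)
...   | no a≢1+k = subst (_≤ c) (sym (s-fix a≢k a≢1+k)) a≤c

s-preserves-> : ∀ {k c a} → k ≢ c → c < a → c < s k a
s-preserves-> {k} {c} {a} k≢c c<a with a ≟ k
... | yes refl = subst (c <_) (sym (s-at a)) (m<n⇒m<1+n c<a)
... | no a≢k with a ≟ suc k
...   | yes refl = subst (c <_) (sym (s-at-suc k)) (≤∧≢⇒< (≤-pred c<a) (k≢c ∘ sym))
...   | no a≢1+k = subst (c <_) (sym (s-fix a≢k a≢1+k)) c<a

toℕ : Bool → ℕ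
toℕ b = if b then 1 else 0

toℕ≡0 : ∀ {b} → toℕ b ≡ 0 → b ≡ false
toℕ≡0 {false} _ = refl

<ᵇ-true : ∀ {a b} → a < b → (a <ᵇ b) ≡ true
<ᵇ-true {a} {b} = dec-true (a <? b)

<ᵇ-false : ∀ {a b} → b ≤ a → (a <ᵇ b) ≡ false
<ᵇ-false {a} {b} b≤a = dec-false (a <? b) (≤⇒≯ b≤a)

<ᵇ-false⇒≥ : ∀ {a b} → (a <ᵇ b) ≡ false → b ≤ a
<ᵇ-false⇒≥ a≮b = ≮⇒≥ (λ a<b → case trans (sym (<ᵇ-true a<b)) a≮b of λ ())

<ᵇ-flip : ∀ {a b} → a ≢ b → (a <ᵇ b) ≡ not (b <ᵇ a)
<ᵇ-flip {a} {b} a≢b with <-cmp a b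
... | tri< a<b _ _ = trans (<ᵇ-true a<b) (cong not (sym (<ᵇ-false (<⇒≤ a<b))))
... | tri≈ _ a≡b _ = ⊥-elim (a≢b a≡b)
... | tri> _ _ b<a = trans (<ᵇ-false (<⇒≤ b<a)) (cong not (sym (<ᵇ-true b<a)))

descent : (ℕ → ℕ) → ℕ → Bool
descent y k = y (suc k) <ᵇ y k

step : Bool → ℕ → (ℕ → ℕ) → ℕ → ℕ
step b k y = if b then (λ a → y (s k a)) else y

after : (ℕ → ℕ) → List ℕ → List Bool → ℕ → ℕ
after y (k ∷ ks) (b ∷ bs) = after (step b k y) ks bs
after y _        _        = y

after-preserves : ∀ {Q : ℕ → Set} (G : (ℕ → ℕ) → Set) →
  (∀ {k y} → Q k → G y → G (λ a → y (s k a))) →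
  ∀ {ks} bs {y} → All Q ks → G y → G (after y ks bs)
after-preserves G keeps _            []       Gy = Gy
after-preserves G keeps []           (_ ∷ _)  Gy = Gy
after-preserves G keeps (true ∷ bs)  (q ∷ qs) Gy = after-preserves G keeps bs qs (keeps q Gy)
after-preserves G keeps (false ∷ bs) (q ∷ qs) Gy = after-preserves G keeps bs qs Gy

Injective : (ℕ → ℕ) → Set
Injective y = ∀ {a b} → y a ≡ y b → a ≡ b

injective-step : ∀ {k y} → Injective y → Injective (λ a → y (s k a))
injective-step {k} inj {a} {b} eq =
  trans (sym (s-involutive k a)) (trans (cong (s k) (inj eq)) (s-involutive k b))

PreservesCut : (ℕ → ℕ) → ℕ → Set
PreservesCut y c = ∀ a → (a ≤ c → y a ≤ c) × (c < a → c < y a)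

cut-step : ∀ {k c y} → k ≢ c → PreservesCut y c → PreservesCut (λ a → y (s k a)) c
cut-step k≢c cut a =
  (λ a≤c → proj₁ (cut _) (s-preserves-≤ k≢c a≤c)) ,
  (λ c<a → proj₂ (cut _) (s-preserves-> k≢c c<a))

after-fixed : ∀ {a ks} bs y → All (λ k → s k a ≡ a) ks → after y ks bs a ≡ y a
after-fixed {a} bs y fixed =
  after-preserves (λ z → z a ≡ y a) (λ {_} {z} sa≡a za≡ya → trans (cong z sa≡a) za≡ya) bs fixed refl

prod-fixed : ∀ {a ks} → All (λ k → s k a ≡ a) ks → prod ks a ≡ a
prod-fixed []                = refl
prod-fixed {a} (sa≡a ∷ fixed) = trans (cong (s _) (prod-fixed fixed)) sa≡a

-- D0 word x and E0 word x are skipped (λ d → d) (λ a → a) word (toList x) and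
-- skipped not (λ a → a) word (toList x).
skipped : (Bool → Bool) → (ℕ → ℕ) → List ℕ → List Bool → ℕ
skipped p y ks bs = countPairs (λ b d → not b ∧ p d) bs (defectFlags y ks bs)

skipped-++ : ∀ p y ks {ks′} bs {bs′} → length ks ≡ length bs →
  skipped p y (ks ++ ks′) (bs ++ bs′) ≡ skipped p y ks bs + skipped p (after y ks bs) ks′ bs′
skipped-++ p y []       []       _  = refl
skipped-++ p y (k ∷ ks) (b ∷ bs) eq =
  trans (cong (_ +_) (skipped-++ p (step b k y) ks bs (suc-injective eq)))
        (sym (+-assoc (toℕ (not b ∧ p (descent y k))) _ _))

window : (ℕ → ℕ) → ℕ → ℕ → ℕ
window y P i = y (i + P)

defectFlags-cong : ∀ {f g} → (∀ a → f a ≡ g a) → ∀ ks bs → defectFlags f ks bs ≡ defectFlags g ks bs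
defectFlags-cong         f≗g []       _        = refl
defectFlags-cong         f≗g (_ ∷ _)  []       = refl
defectFlags-cong {f} {g} f≗g (k ∷ ks) (b ∷ bs) =
  cong₂ _∷_ (cong₂ _<ᵇ_ (f≗g (suc k)) (f≗g k)) (defectFlags-cong (step-cong b) ks bs)
  where
  step-cong : ∀ b a → step b k f a ≡ step b k g a
  step-cong true  a = f≗g (s k a)
  step-cong false a = f≗g a

after-cong : ∀ {f g} → (∀ a → f a ≡ g a) → ∀ ks bs a → after f ks bs a ≡ after g ks bs a
after-cong f≗g []       _        = f≗g
after-cong f≗g (_ ∷ _)  []       = f≗g
after-cong f≗g (k ∷ ks) (true ∷ bs)  = after-cong (f≗g ∘ s k) ks bs
after-cong f≗g (k ∷ ks) (false ∷ bs) = after-cong f≗g ks bs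

step-shift : ∀ P b k y a → window (step b (k + P) y) P a ≡ step b k (window y P) a
step-shift P true  k y a = cong y (s-shift P k a)
step-shift P false k y a = refl

defectFlags-shift : ∀ P y ks bs → defectFlags y (map (_+ P) ks) bs ≡ defectFlags (window y P) ks bs
defectFlags-shift P y []       _        = refl
defectFlags-shift P y (_ ∷ _)  []       = refl
defectFlags-shift P y (k ∷ ks) (b ∷ bs) = cong (descent y (k + P) ∷_)
  (trans (defectFlags-shift P (step b (k + P) y) ks bs)
         (defectFlags-cong (step-shift P b k y) ks bs))

after-shift : ∀ P y ks bs a → window (after y (map (_+ P) ks) bs) P a ≡ after (window y P) ks bs a
after-shift P y []       _        a = refl
after-shift P y (_ ∷ _)  []       a = refl
after-shift P y (k ∷ ks) (b ∷ bs) a =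
  trans (after-shift P (step b (k + P) y) ks bs a) (after-cong (step-shift P b k y) ks bs a)

prod-shift : ∀ P ks i → prod (map (_+ P) ks) (i + P) ≡ prod ks i + P
prod-shift P []       i = refl
prod-shift P (k ∷ ks) i = trans (cong (s (k + P)) (prod-shift P ks i)) (s-shift P k (prod ks i))

SameOrderUpTo : ℕ → (ℕ → ℕ) → (ℕ → ℕ) → Set
SameOrderUpTo c f g = ∀ {a b} → a ≤ c → b ≤ c → (f a <ᵇ f b) ≡ (g a <ᵇ g b)

step-sameOrder : ∀ {c f g k} b → k < c → SameOrderUpTo c f g → SameOrderUpTo c (step b k f) (step b k g)
step-sameOrder true  k<c f≈g a≤c b≤c =
  f≈g (s-preserves-≤ (<⇒≢ k<c) a≤c) (s-preserves-≤ (<⇒≢ k<c) b≤c)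
step-sameOrder false k<c f≈g = f≈g

defectFlags-sameOrder : ∀ {c f g ks} → All (_< c) ks → SameOrderUpTo c f g →
  ∀ bs → defectFlags f ks bs ≡ defectFlags g ks bs
defectFlags-sameOrder []         f≈g _        = refl
defectFlags-sameOrder (_ ∷ _)    f≈g []       = refl
defectFlags-sameOrder (k<c ∷ ks<c) f≈g (b ∷ bs) =
  cong₂ _∷_ (f≈g k<c (<⇒≤ k<c)) (defectFlags-sameOrder ks<c (step-sameOrder b k<c f≈g) bs)

after-sameOrder : ∀ {c f g ks} → All (_< c) ks → SameOrderUpTo c f g →
  ∀ bs → SameOrderUpTo c (after f ks bs) (after g ks bs)
after-sameOrder []         f≈g _        = f≈g
after-sameOrder (_ ∷ _)    f≈g []       = f≈g
after-sameOrder (k<c ∷ ks<c) f≈g (b ∷ bs) = after-sameOrder ks<c (step-sameOrder b k<c f≈g) bs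

-- Counting inversions

range : ℕ → ℕ → List ℕ
range c zero    = []
range c (suc l) = c ∷ range (suc c) l

range-++ : ∀ c a b → range c (a + b) ≡ range c a ++ range (c + a) b
range-++ c zero    b = cong (λ c′ → range c′ b) (sym (+-identityʳ c))
range-++ c (suc a) b = cong (c ∷_)
  (trans (range-++ (suc c) a b) (cong (λ c′ → range (suc c) a ++ range c′ b) (sym (+-suc c a))))

range-bounds : ∀ c l → All (λ b → c ≤ b × b < c + l) (range c l)
range-bounds c zero    = []
range-bounds c (suc l) =
  (≤-refl , subst (c <_) (sym (+-suc c l)) (s≤s (m≤m+n c l))) ∷
  All.map (λ { {b} (c<b , b<) → <⇒≤ c<b , subst (b <_) (sym (+-suc c l)) b< }) (range-bounds (suc c) l)

map-suc-range : ∀ c l → map suc (range c l) ≡ range (suc c) l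
map-suc-range c zero    = refl
map-suc-range c (suc l) = cong (suc c ∷_) (map-suc-range (suc c) l)

upTo-range : ∀ m → upTo m ≡ range 0 m
upTo-range m = trans (applyUpTo-range (λ a → a) m) (map-id (range 0 m))
  where
  applyUpTo-range : ∀ f m → applyUpTo f m ≡ map f (range 0 m)
  applyUpTo-range f zero    = refl
  applyUpTo-range f (suc m) = cong (f 0 ∷_)
    (trans (applyUpTo-range (f ∘ suc) m) (trans (map-∘ (range 0 m)) (cong (map f) (map-suc-range 0 m))))

filter-above : ∀ {a m} → a < m → filter (a <?_) (range 0 m) ≡ range (suc a) (m ∸ suc a)
filter-above {a} {m} a<m = begin
  filter (a <?_) (range 0 m)
    ≡⟨ cong (filter (a <?_) ∘ range 0) (sym (m+[n∸m]≡n a<m)) ⟩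
  filter (a <?_) (range 0 (suc a + (m ∸ suc a)))
    ≡⟨ cong (filter (a <?_)) (range-++ 0 (suc a) (m ∸ suc a)) ⟩
  filter (a <?_) (range 0 (suc a) ++ range (suc a) (m ∸ suc a))
    ≡⟨ filter-++ (a <?_) (range 0 (suc a)) _ ⟩
  filter (a <?_) (range 0 (suc a)) ++ filter (a <?_) (range (suc a) (m ∸ suc a))
    ≡⟨ cong₂ _++_
         (filter-none (a <?_) (All.map (λ (_ , b≤a) → ≤⇒≯ (≤-pred b≤a)) (range-bounds 0 (suc a))))
         (filter-all (a <?_) (All.map proj₁ (range-bounds (suc a) _))) ⟩
  range (suc a) (m ∸ suc a) ∎
  where open ≡-Reasoning

module _ {A B : Set} where

  length-filter-map : ∀ {P : B → Set} (P? : ∀ b → Dec (P b)) (g : A → B) xs →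
    length (filter P? (map g xs)) ≡ length (filter (P? ∘ g) xs)
  length-filter-map P? g []       = refl
  length-filter-map P? g (x ∷ xs) with does (P? (g x))
  ... | true  = cong suc (length-filter-map P? g xs)
  ... | false = length-filter-map P? g xs

  length-filter-concatMap : ∀ {P : B → Set} (P? : ∀ b → Dec (P b)) (F : A → List B) xs →
    length (filter P? (concatMap F xs)) ≡ sum (map (λ a → length (filter P? (F a))) xs)
  length-filter-concatMap P? F []       = refl
  length-filter-concatMap P? F (x ∷ xs) = begin
    length (filter P? (F x ++ concatMap F xs))
      ≡⟨ cong length (filter-++ P? (F x) (concatMap F xs)) ⟩
    length (filter P? (F x) ++ filter P? (concatMap F xs))
      ≡⟨ length-++ (filter P? (F x)) ⟩
    length (filter P? (F x)) + length (filter P? (concatMap F xs))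
      ≡⟨ cong (length (filter P? (F x)) +_) (length-filter-concatMap P? F xs) ⟩
    length (filter P? (F x)) + sum (map (λ a → length (filter P? (F a))) xs) ∎
    where open ≡-Reasoning

below : ℕ → List ℕ → ℕ
below a xs = length (filter (_<? a) xs)

inv : List ℕ → ℕ
inv []       = 0
inv (a ∷ as) = below a as + inv as

rows-inv : ∀ (f : ℕ → ℕ) c l {N} → c + l ≡ N →
  sum (map (λ a → length (filter (λ b → f b <? f a) (range (suc a) (N ∸ suc a)))) (range c l))
    ≡ inv (map f (range c l))
rows-inv f c zero    _   = refl
rows-inv f c (suc l) {N} c+l≡N = cong₂ _+_
  (trans (cong (λ r → length (filter (λ b → f b <? f c) (range (suc c) r))) N∸c≡l)
         (sym (length-filter-map (_<? f c) f (range (suc c) l))))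
  (rows-inv f (suc c) l (trans (sym (+-suc c l)) c+l≡N))
  where
  N∸c≡l : N ∸ suc c ≡ l
  N∸c≡l = trans (cong (_∸ suc c) (trans (sym c+l≡N) (+-suc c l))) (m+n∸m≡n (suc c) l)

inversions≡inv : ∀ m v → inversions m v ≡ inv (map v (range 1 m))
inversions≡inv m v = begin
  inversions m v
    ≡⟨ length-filter-concatMap (λ p → v (proj₂ p) <? v (proj₁ p)) pairsFrom (upTo m) ⟩
  sum (map (λ a → length (filter (λ p → v (proj₂ p) <? v (proj₁ p)) (pairsFrom a))) (upTo m))
    ≡⟨ cong sum (map-cong (λ a → length-filter-map (λ p → v (proj₂ p) <? v (proj₁ p))
                                                  (λ b → suc a , suc b) (filter (a <?_) (upTo m))) (upTo m)) ⟩
  sum (map (λ a → row a (filter (a <?_) (upTo m))) (upTo m))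
    ≡⟨ cong (λ r → sum (map (λ a → row a (filter (a <?_) r)) r)) (upTo-range m) ⟩
  sum (map (λ a → row a (filter (a <?_) (range 0 m))) (range 0 m))
    ≡⟨ cong sum (map-cong-local
         (All.map (λ (_ , a<m) → cong (row _) (filter-above a<m)) (range-bounds 0 m))) ⟩
  sum (map (λ a → row a (range (suc a) (m ∸ suc a))) (range 0 m))
    ≡⟨ rows-inv (v ∘ suc) 0 m refl ⟩
  inv (map (v ∘ suc) (range 0 m))
    ≡⟨ cong inv (trans (map-∘ (range 0 m)) (cong (map v) (map-suc-range 0 m))) ⟩
  inv (map v (range 1 m)) ∎
  where
  open ≡-Reasoning
  pairsFrom : ℕ → List (ℕ × ℕ)
  pairsFrom a = map (λ b → suc a , suc b) (filter (a <?_) (upTo m))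
  row : ℕ → List ℕ → ℕ
  row a bs = length (filter (λ b → v (suc b) <? v (suc a)) bs)

below-∷ : ∀ a x xs → below a (x ∷ xs) ≡ toℕ (x <ᵇ a) + below a xs
below-∷ a x xs with x <ᵇ a
... | true  = refl
... | false = refl

below-swap : ∀ a xs c d zs → below a (xs ++ c ∷ d ∷ zs) ≡ below a (xs ++ d ∷ c ∷ zs)
below-swap a []       c d zs
  rewrite below-∷ a c (d ∷ zs) | below-∷ a d zs | below-∷ a d (c ∷ zs) | below-∷ a c zs =
  x∙yz≈y∙xz (toℕ (c <ᵇ a)) (toℕ (d <ᵇ a)) (below a zs)
below-swap a (x ∷ xs) c d zs
  rewrite below-∷ a x (xs ++ c ∷ d ∷ zs) | below-∷ a x (xs ++ d ∷ c ∷ zs) =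
  cong (toℕ (x <ᵇ a) +_) (below-swap a xs c d zs)

inv-swap : ∀ xs {c d} zs → c < d → inv (xs ++ d ∷ c ∷ zs) ≡ suc (inv (xs ++ c ∷ d ∷ zs))
inv-swap [] {c} {d} zs c<d
  rewrite below-∷ d c zs | below-∷ c d zs | <ᵇ-true c<d | <ᵇ-false {d} {c} (<⇒≤ c<d) =
  cong suc (x∙yz≈y∙xz (below d zs) (below c zs) (inv zs))
inv-swap (x ∷ xs) {c} {d} zs c<d =
  trans (cong₂ _+_ (below-swap x xs d c zs) (inv-swap xs zs c<d)) (+-suc (below x (xs ++ c ∷ d ∷ zs)) _)

range-around : ∀ k r → range 1 (k + suc (suc r)) ≡ range 1 k ++ suc k ∷ suc (suc k) ∷ range (3 + k) r
range-around k r = range-++ 1 k (suc (suc r))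

s-range-around : ∀ k r →
  map (s (suc k)) (range 1 (k + suc (suc r))) ≡ range 1 k ++ suc (suc k) ∷ suc k ∷ range (3 + k) r
s-range-around k r
  rewrite range-around k r | map-++ (s (suc k)) (range 1 k) (suc k ∷ suc (suc k) ∷ range (3 + k) r)
        | s-at (suc k) | s-at-suc (suc k)
        | map-id-local (All.map (λ (_ , b<1+k) → s-fix-< b<1+k) (range-bounds 1 k))
        | map-id-local (All.map (λ (3+k≤b , _) → s-fix-> 3+k≤b) (range-bounds (3 + k) r)) = refl

inversions-step : ∀ {m k y} → Injective y → 1 ≤ k → k < m → descent y k ≡ false →
  inversions m (λ a → y (s k a)) ≡ suc (inversions m y)
inversions-step {m} {suc k} {y} inj _ k<m ascent =
  subst (λ M → inversions M (λ a → y (s (suc k) a)) ≡ suc (inversions M y)) m≡ (begin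
    inversions M (λ a → y (s (suc k) a))
      ≡⟨ inversions≡inv M _ ⟩
    inv (map (y ∘ s (suc k)) (range 1 M))
      ≡⟨ cong inv (trans (map-∘ (range 1 M)) (cong (map y) (s-range-around k r))) ⟩
    inv (map y (range 1 k ++ suc (suc k) ∷ suc k ∷ range (3 + k) r))
      ≡⟨ cong inv (map-++ y (range 1 k) _) ⟩
    inv (map y (range 1 k) ++ y (suc (suc k)) ∷ y (suc k) ∷ map y (range (3 + k) r))
      ≡⟨ inv-swap (map y (range 1 k)) _ y₁<y₂ ⟩
    suc (inv (map y (range 1 k) ++ y (suc k) ∷ y (suc (suc k)) ∷ map y (range (3 + k) r)))
      ≡⟨ cong (suc ∘ inv) (sym (trans (cong (map y) (range-around k r)) (map-++ y (range 1 k) _))) ⟩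
    suc (inv (map y (range 1 M)))
      ≡⟨ cong suc (sym (inversions≡inv M y)) ⟩
    suc (inversions M y) ∎)
  where
  open ≡-Reasoning
  r = m ∸ suc (suc k)
  M = k + suc (suc r)
  m≡ : M ≡ m
  m≡ = trans (+-suc k (suc r)) (trans (cong suc (+-suc k r)) (m+[n∸m]≡n k<m))
  y₁<y₂ : y (suc k) < y (suc (suc k))
  y₁<y₂ = ≤∧≢⇒< (<ᵇ-false⇒≥ ascent) (λ eq → 1+n≢n (sym (inj eq)))

inversions-cong : ∀ m {f g} → (∀ a → f a ≡ g a) → inversions m f ≡ inversions m g
inversions-cong m {f} {g} f≗g =
  trans (inversions≡inv m f) (trans (cong inv (map-cong f≗g (range 1 m))) (sym (inversions≡inv m g)))

inversions-id : ∀ m → inversions m (λ a → a) ≡ 0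
inversions-id m = trans (inversions≡inv m _) (trans (cong inv (map-id (range 1 m))) (inv-range 1 m))
  where
  inv-range : ∀ c l → inv (range c l) ≡ 0
  inv-range c zero    = refl
  inv-range c (suc l)
    rewrite filter-none (_<? c) (All.map (λ (c<b , _) → ≤⇒≯ (<⇒≤ c<b)) (range-bounds (suc c) l)) =
    inv-range (suc c) l

allOnes : List ℕ → List Bool
allOnes ks = replicate (length ks) true

after-allOnes : ∀ ks y a → after y ks (allOnes ks) a ≡ y (prod ks a)
after-allOnes []       y a = refl
after-allOnes (k ∷ ks) y a = after-allOnes ks (λ b → y (s k b)) a

inversions-ascending : ∀ {m ks} y → IsWordIn m ks → Injective y →
  All (_≡ false) (defectFlags y ks (allOnes ks)) →
  inversions m (after y ks (allOnes ks)) ≡ length ks + inversions m y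
inversions-ascending y []                       inj []              = refl
inversions-ascending {m} {k ∷ ks} y ((1≤k , k<m) ∷ inRange) inj (ascent ∷ ascents) =
  trans (inversions-ascending (λ a → y (s k a)) inRange (injective-step inj) ascents)
        (trans (cong (length ks +_) (inversions-step inj 1≤k k<m ascent)) (+-suc (length ks) _))

-- One block, checked exhaustively

modelWord : List ℕ
modelWord = 1 ∷ 0 ∷ 2 ∷ 1 ∷ []

modelWord<3 : All (_< 3) modelWord
modelWord<3 = s≤s (s≤s z≤n) ∷ s≤s z≤n ∷ s≤s (s≤s (s≤s z≤n)) ∷ s≤s (s≤s z≤n) ∷ []

-- The order type of the four positions of a block whose left (right) pair is inverted iff X (Y).
ranks : Bool → Bool → ℕ → ℕ
ranks X Y 0 = toℕ X
ranks X Y 1 = toℕ (not X)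
ranks X Y 2 = 2 + toℕ Y
ranks X Y _ = 2 + toℕ (not Y)

window≈ranks : ∀ {w c} → w 0 ≤ c → w 1 ≤ c → c < w 2 → c < w 3 → w 0 ≢ w 1 → w 2 ≢ w 3 →
  SameOrderUpTo 3 w (ranks (descent w 0) (descent w 2))
window≈ranks {w} w₀≤c w₁≤c c<w₂ c<w₃ w₀≢w₁ w₂≢w₃ = same
  where
  X = descent w 0
  Y = descent w 2
  irrefl : ∀ a b → (a <ᵇ a) ≡ (b <ᵇ b)
  irrefl a b = trans (<ᵇ-false {a} ≤-refl) (sym (<ᵇ-false {b} ≤-refl))
  across-up : ∀ {a b} b′ m → a < b → (a <ᵇ b) ≡ (toℕ b′ <ᵇ 2 + m)
  across-up false m a<b = <ᵇ-true a<b
  across-up true  m a<b = <ᵇ-true a<b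
  across-down : ∀ {a b} b′ m → a < b → (b <ᵇ a) ≡ (2 + m <ᵇ toℕ b′)
  across-down false m a<b = <ᵇ-false (<⇒≤ a<b)
  across-down true  m a<b = <ᵇ-false (<⇒≤ a<b)
  inside-up : ∀ {a b} → a ≢ b → (a <ᵇ b) ≡ (toℕ (b <ᵇ a) <ᵇ toℕ (not (b <ᵇ a)))
  inside-up {a} {b} a≢b with b <ᵇ a | <ᵇ-flip a≢b
  ... | false | a<b = a<b
  ... | true  | a<b = a<b
  inside-down : ∀ b′ → b′ ≡ (toℕ (not b′) <ᵇ toℕ b′)
  inside-down false = refl
  inside-down true  = refl
  same : SameOrderUpTo 3 w (ranks X Y)
  same z≤n                   z≤n                   = irrefl (w 0) (toℕ X)
  same z≤n                   (s≤s z≤n)             = inside-up w₀≢w₁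
  same z≤n                   (s≤s (s≤s z≤n))       = across-up X (toℕ Y) (≤-<-trans w₀≤c c<w₂)
  same z≤n                   (s≤s (s≤s (s≤s z≤n))) = across-up X (toℕ (not Y)) (≤-<-trans w₀≤c c<w₃)
  same (s≤s z≤n)             z≤n                   = inside-down X
  same (s≤s z≤n)             (s≤s z≤n)             = irrefl (w 1) (toℕ (not X))
  same (s≤s z≤n)             (s≤s (s≤s z≤n))       = across-up (not X) (toℕ Y) (≤-<-trans w₁≤c c<w₂)
  same (s≤s z≤n)             (s≤s (s≤s (s≤s z≤n))) = across-up (not X) (toℕ (not Y)) (≤-<-trans w₁≤c c<w₃)
  same (s≤s (s≤s z≤n))       z≤n                   = across-down X (toℕ Y) (≤-<-trans w₀≤c c<w₂)
  same (s≤s (s≤s z≤n))       (s≤s z≤n)             = across-down (not X) (toℕ Y) (≤-<-trans w₁≤c c<w₂)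
  same (s≤s (s≤s z≤n))       (s≤s (s≤s z≤n))       = irrefl (w 2) (2 + toℕ Y)
  same (s≤s (s≤s z≤n))       (s≤s (s≤s (s≤s z≤n))) = inside-up w₂≢w₃
  same (s≤s (s≤s (s≤s z≤n))) z≤n                   = across-down X (toℕ (not Y)) (≤-<-trans w₀≤c c<w₃)
  same (s≤s (s≤s (s≤s z≤n))) (s≤s z≤n)             = across-down (not X) (toℕ (not Y)) (≤-<-trans w₁≤c c<w₃)
  same (s≤s (s≤s (s≤s z≤n))) (s≤s (s≤s z≤n))       = inside-down Y
  same (s≤s (s≤s (s≤s z≤n))) (s≤s (s≤s (s≤s z≤n))) = irrefl (w 3) (2 + toℕ (not Y))

everyMask : ∀ k → (Vec Bool k → Bool) → Bool
everyMask zero    p = p []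
everyMask (suc k) p = everyMask k (p ∘ (false ∷_)) ∧ everyMask k (p ∘ (true ∷_))

everyMask-sound : ∀ k p → T (everyMask k p) → ∀ v → T (p v)
everyMask-sound zero    p holds []          = holds
everyMask-sound (suc k) p holds (false ∷ v) = everyMask-sound k _ (proj₁ (Equivalence.to T-∧ holds)) v
everyMask-sound (suc k) p holds (true ∷ v)  = everyMask-sound k _ (proj₂ (Equivalence.to T-∧ holds)) v

≤-by-exhaustion : ∀ k (l r : Vec Bool k → ℕ) → T (everyMask k (λ v → l v ≤ᵇ r v)) →
  ∀ v → l v ≤ r v
≤-by-exhaustion k l r holds v = ≤ᵇ⇒≤ (l v) (r v) (everyMask-sound k _ holds v)

modelD modelE : Bool → Bool → List Bool → ℕ
modelD X Y bs = skipped (λ d → d) (ranks X Y) modelWord bs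
modelE X Y bs = skipped not (ranks X Y) modelWord bs

modelOut : Bool → Bool → List Bool → ℕ → ℕ
modelOut X Y bs k = toℕ (descent (after (ranks X Y) modelWord bs) k)

someSkipped : List Bool → ℕ
someSkipped bs = toℕ (not (and bs))

model-bound : ∀ X Y (bs : Vec Bool 4) → let m = toList bs in
  modelD X Y m + someSkipped m ≤ modelE X Y m + toℕ X + toℕ Y
model-bound X Y bs = ≤-by-exhaustion 6
  (λ { (X ∷ Y ∷ bs) → modelD X Y (toList bs) + someSkipped (toList bs) })
  (λ { (X ∷ Y ∷ bs) → modelE X Y (toList bs) + toℕ X + toℕ Y }) _ (X ∷ Y ∷ bs)

weight-as-Bool : ∀ {c} → c ≤ 1 → Σ Bool (λ b → toℕ b ≡ c)
weight-as-Bool z≤n       = false , refl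
weight-as-Bool (s≤s z≤n) = true , refl

-- In model-right (model-left) c = 1 exactly when the block to the right (left), which reads the
-- right (left) pair next, is still unread.
model-right : ∀ X Y {c} → c ≤ 1 → (bs : Vec Bool 4) → let m = toList bs in
  modelD X Y m + c * modelOut X Y m 2 ≤ modelE X Y m + toℕ X + c * toℕ Y
model-right X Y c≤1 bs with weight-as-Bool c≤1
... | bR , refl = ≤-by-exhaustion 7
  (λ { (X ∷ Y ∷ bR ∷ bs) → modelD X Y (toList bs) + toℕ bR * modelOut X Y (toList bs) 2 })
  (λ { (X ∷ Y ∷ bR ∷ bs) → modelE X Y (toList bs) + toℕ X + toℕ bR * toℕ Y }) _ (X ∷ Y ∷ bR ∷ bs)

model-left : ∀ X Y {c} → c ≤ 1 → (bs : Vec Bool 4) → let m = toList bs in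
  modelD X Y m + c * modelOut X Y m 0 ≤ modelE X Y m + toℕ Y + c * toℕ X
model-left X Y c≤1 bs with weight-as-Bool c≤1
... | bL , refl = ≤-by-exhaustion 7
  (λ { (X ∷ Y ∷ bL ∷ bs) → modelD X Y (toList bs) + toℕ bL * modelOut X Y (toList bs) 0 })
  (λ { (X ∷ Y ∷ bL ∷ bs) → modelE X Y (toList bs) + toℕ Y + toℕ bL * toℕ X }) _ (X ∷ Y ∷ bL ∷ bs)

-- For j ≥ 1, doubledWord (j ∷ js) is definitionally block (2 * j ∸ 1) ++ doubledWord js.
block : ℕ → List ℕ
block P = map (_+ P) modelWord

window-sameOrder : ∀ {y P} → PreservesCut y (suc P) → Injective y →
  SameOrderUpTo 3 (window y P) (ranks (descent y P) (descent y (2 + P)))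
window-sameOrder {y} {P} cut inj = window≈ranks {window y P}
  (proj₁ (cut P) (n≤1+n P)) (proj₁ (cut (suc P)) ≤-refl)
  (proj₂ (cut (2 + P)) ≤-refl) (proj₂ (cut (3 + P)) (n≤1+n _))
  (1+n≢n ∘ sym ∘ inj) (1+n≢n ∘ sym ∘ inj)

block-flags : ∀ {y P} → PreservesCut y (suc P) → Injective y → ∀ bs →
  defectFlags y (block P) bs ≡ defectFlags (ranks (descent y P) (descent y (2 + P))) modelWord bs
block-flags {y} {P} cut inj bs =
  trans (defectFlags-shift P y modelWord bs) (defectFlags-sameOrder modelWord<3 (window-sameOrder cut inj) bs)

skipped-block : ∀ p {y P} → PreservesCut y (suc P) → Injective y → ∀ bs →
  skipped p y (block P) bs ≡ skipped p (ranks (descent y P) (descent y (2 + P))) modelWord bs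
skipped-block p cut inj bs = cong (countPairs _ bs) (block-flags cut inj bs)

block-descent : ∀ {y P} → PreservesCut y (suc P) → Injective y → ∀ bs {k} → k < 3 →
  descent (after y (block P) bs) (k + P) ≡ descent (after (ranks (descent y P) (descent y (2 + P))) modelWord bs) k
block-descent {y} {P} cut inj bs {k} k<3 =
  trans (cong₂ _<ᵇ_ (after-shift P y modelWord bs (suc k)) (after-shift P y modelWord bs k))
        (after-sameOrder modelWord<3 (window-sameOrder cut inj) bs k<3 (<⇒≤ k<3))

block-fixes : ∀ {P a} → a ≢ P → a ≢ 1 + P → a ≢ 2 + P → a ≢ 3 + P →
  All (λ k → s k a ≡ a) (block P)
block-fixes a≢P a≢1+P a≢2+P a≢3+P =
  s-fix a≢1+P a≢2+P ∷ s-fix a≢P a≢1+P ∷ s-fix a≢2+P a≢3+P ∷ s-fix a≢1+P a≢2+P ∷ []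

odd-pred : ∀ c → 2 * suc c ∸ 1 ≡ suc (2 * c)
odd-pred c = cong (_∸ 1) (*-suc 2 c)

outside-even : ∀ m {c} → c ≢ suc m → c ≢ suc (suc m) →
  All (λ k → s k (2 * c) ≡ 2 * c) (block (2 * suc m ∸ 1))
outside-even m {c} c≢j c≢j+1 = block-fixes
  (λ 2c≡P → even≢odd c m (trans 2c≡P (odd-pred m)))
  (c≢j ∘ *-cancelˡ-≡ c (suc m) 2)
  (even≢odd c (suc m))
  (λ 2c≡3+P → c≢j+1 (*-cancelˡ-≡ c (suc (suc m)) 2 (trans 2c≡3+P (sym (*-suc 2 (suc m))))))

outside-odd : ∀ m {c} → c ≢ m → c ≢ suc m →
  All (λ k → s k (suc (2 * c)) ≡ suc (2 * c)) (block (2 * suc m ∸ 1))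
outside-odd m {c} c≢m c≢j = block-fixes
  (λ 2c+1≡P → c≢m (*-cancelˡ-≡ c m 2 (suc-injective (trans 2c+1≡P (odd-pred m)))))
  (even≢odd (suc m) c ∘ sym)
  (c≢j ∘ *-cancelˡ-≡ c (suc m) 2 ∘ suc-injective)
  (λ 2c+1≡3+P → even≢odd (suc (suc m)) c (sym (trans 2c+1≡3+P (sym (*-suc 2 (suc m))))))

block-avoids-cut : ∀ m {j} → j ≢ suc m → All (_≢ 2 * j) (block (2 * suc m ∸ 1))
block-avoids-cut m {j} j≢j′ =
  (j≢j′ ∘ sym ∘ *-cancelˡ-≡ (suc m) j 2) ∷
  (λ P≡2j → even≢odd j m (trans (sym P≡2j) (odd-pred m))) ∷
  (even≢odd j (suc m) ∘ sym) ∷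
  (j≢j′ ∘ sym ∘ *-cancelˡ-≡ (suc m) j 2) ∷ []

block-injective : ∀ {y} P bs → Injective y → Injective (after y (block P) bs)
block-injective P bs = after-preserves Injective (λ _ → injective-step) bs (All.universal (λ _ → tt) (block P))

block-preservesCuts : ∀ m {y js} bs → All (suc m ≢_) js → All (λ j → PreservesCut y (2 * j)) js →
  All (λ j → PreservesCut (after y (block (2 * suc m ∸ 1)) bs) (2 * j)) js
block-preservesCuts m bs j∉js cuts = All.zipWith
  (λ { {j} (j′≢j , cut) →
        after-preserves (λ z → PreservesCut z (2 * j)) cut-step bs (block-avoids-cut m (j′≢j ∘ sym)) cut })
  (j∉js , cuts)

pairInversion : (ℕ → ℕ) → ℕ → ℕ
pairInversion y i = toℕ (y (2 * i) <ᵇ y (2 * i ∸ 1))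

pairInversion-right : ∀ y m → pairInversion y (suc (suc m)) ≡ toℕ (descent y (2 + (2 * suc m ∸ 1)))
pairInversion-right y m = cong₂ (λ a b → toℕ (y a <ᵇ y b)) (*-suc 2 (suc m)) (odd-pred (suc m))

pairInversion-outside : ∀ m {i} y bs → i ≢ suc m → i ≢ suc (suc m) →
  pairInversion (after y (block (2 * suc m ∸ 1)) bs) i ≡ pairInversion y i
pairInversion-outside m {i} y bs i≢j i≢j+1 =
  cong₂ (λ a b → toℕ (a <ᵇ b))
    (after-fixed bs y (outside-even m i≢j i≢j+1)) (after-fixed bs y (odd-fixed i i≢j i≢j+1))
  where
  odd-fixed : ∀ i → i ≢ suc m → i ≢ suc (suc m) →
    All (λ k → s k (2 * i ∸ 1) ≡ 2 * i ∸ 1) (block (2 * suc m ∸ 1))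
  odd-fixed zero    i≢j i≢j+1 = outside-even m i≢j i≢j+1  -- 2 * 0 ∸ 1 is 0 = 2 * 0
  odd-fixed (suc i) i≢j i≢j+1 rewrite odd-pred i = outside-odd m (i≢j ∘ cong suc) (i≢j+1 ∘ cong suc)

block-left-output : ∀ m {y} → let P = 2 * suc m ∸ 1 in PreservesCut y (suc P) → Injective y → ∀ bs →
  pairInversion (after y (block P) bs) (suc m) ≡ modelOut (descent y P) (descent y (2 + P)) bs 0
block-left-output m cut inj bs = cong toℕ (block-descent cut inj bs (s≤s z≤n))

block-right-output : ∀ m {y} → let P = 2 * suc m ∸ 1 in PreservesCut y (suc P) → Injective y → ∀ bs →
  pairInversion (after y (block P) bs) (suc (suc m)) ≡ modelOut (descent y P) (descent y (2 + P)) bs 2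
block-right-output m {y} cut inj bs =
  trans (pairInversion-right (after y (block (2 * suc m ∸ 1)) bs) m)
        (cong toℕ (block-descent cut inj bs (s≤s (s≤s (s≤s z≤n)))))

-- The doubled word spells the doubled permutation

-- Inside the window, prod modelWord sends 0, 1, 2, 3 to 2, 3, 0, 1: the block swaps its two pairs.
block-even : ∀ m c → prod (block (2 * suc m ∸ 1)) (2 * c) ≡ 2 * s (suc m) c
block-even m c with c ≟ suc m
... | yes refl = trans (prod-shift P modelWord 1) (sym (trans (cong (2 *_) (s-at c)) (*-suc 2 c)))
  where P = 2 * suc m ∸ 1
... | no c≢j with c ≟ suc (suc m)
...   | yes refl = trans (cong (prod (block P)) (*-suc 2 (suc m)))
                         (trans (prod-shift P modelWord 3) (sym (cong (2 *_) (s-at-suc (suc m)))))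
  where P = 2 * suc m ∸ 1
...   | no c≢j+1 = trans (prod-fixed (outside-even m c≢j c≢j+1)) (cong (2 *_) (sym (s-fix c≢j c≢j+1)))

block-odd : ∀ m {c} → 1 ≤ c → prod (block (2 * suc m ∸ 1)) (2 * c ∸ 1) ≡ 2 * s (suc m) c ∸ 1
block-odd m {suc c} _ with suc c ≟ suc m
... | yes refl = trans (prod-shift P modelWord 0)
                       (sym (trans (cong (λ v → 2 * v ∸ 1) (s-at (suc c))) (odd-pred (suc c))))
  where P = 2 * suc c ∸ 1
... | no c+1≢j with suc c ≟ suc (suc m)
...   | yes refl = trans (cong (λ v → prod (block P) (v ∸ 1)) (*-suc 2 (suc m)))
                         (trans (prod-shift P modelWord 2) (sym (cong (λ v → 2 * v ∸ 1) (s-at-suc (suc m)))))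
  where P = 2 * suc m ∸ 1
...   | no c+1≢j+1 = begin
  prod (block (2 * suc m ∸ 1)) (2 * suc c ∸ 1)
    ≡⟨ cong (prod (block _)) (odd-pred c) ⟩
  prod (block (2 * suc m ∸ 1)) (suc (2 * c))
    ≡⟨ prod-fixed (outside-odd m (c+1≢j ∘ cong suc) (c+1≢j+1 ∘ cong suc)) ⟩
  suc (2 * c)
    ≡⟨ sym (odd-pred c) ⟩
  2 * suc c ∸ 1
    ≡⟨ cong (λ v → 2 * v ∸ 1) (sym (s-fix c+1≢j c+1≢j+1)) ⟩
  2 * s (suc m) (suc c) ∸ 1 ∎
  where open ≡-Reasoning

double-if : ∀ f a {r q₀ q₁} → a % 2 ≡ r → a / 2 ≡ q₀ → (a + 1) / 2 ≡ q₁ →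
  double f a ≡ (if r ≡ᵇ 0 then 2 * f q₀ else 2 * f q₁ ∸ 1)
double-if f a refl refl refl = refl

double-even : ∀ f i → double f (2 * i) ≡ 2 * f i
double-even f i = double-if f (2 * i)
  (trans (cong (_% 2) (*-comm 2 i)) (m*n%n≡0 i 2))
  (trans (cong (_/ 2) (*-comm 2 i)) (m*n/n≡m i 2))
  refl

double-odd : ∀ f i → double f (suc (2 * i)) ≡ 2 * f (suc i) ∸ 1
double-odd f i = double-if f (suc (2 * i))
  (trans (cong (λ v → suc v % 2) (*-comm 2 i)) ([m+kn]%n≡m%n 1 i 2))
  refl
  (trans (cong (_/ 2) (trans (+-comm (suc (2 * i)) 1) (cong (2 +_) (*-comm 2 i)))) (m*n/n≡m (suc i) 2))

data Halves : ℕ → Set where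
  even : ∀ i → Halves (2 * i)
  odd  : ∀ i → Halves (suc (2 * i))

halves : ∀ a → Halves a
halves zero = even 0
halves (suc a) with halves a
... | even i = odd i
... | odd i  = subst Halves (*-suc 2 i) (even (suc i))

prod-positive : ∀ {m js} → IsWordIn m js → ∀ {a} → 0 < a → 0 < prod js a
prod-positive []                     0<a = 0<a
prod-positive ((1≤k , _) ∷ inRange) 0<a = s-preserves-> (>⇒≢ 1≤k) (prod-positive inRange 0<a)

prod-doubledWord-even : ∀ {m js} → IsWordIn m js → ∀ i → prod (doubledWord js) (2 * i) ≡ 2 * prod js i
prod-doubledWord-even []                           i = refl
prod-doubledWord-even {js = suc j ∷ js} (_ ∷ inRange) i =
  trans (cong (prod (block (2 * suc j ∸ 1))) (prod-doubledWord-even inRange i)) (block-even j (prod js i))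

prod-doubledWord-odd : ∀ {m js} → IsWordIn m js → ∀ i →
  prod (doubledWord js) (2 * suc i ∸ 1) ≡ 2 * prod js (suc i) ∸ 1
prod-doubledWord-odd []                           i = refl
prod-doubledWord-odd {js = suc j ∷ js} (_ ∷ inRange) i =
  trans (cong (prod (block (2 * suc j ∸ 1))) (prod-doubledWord-odd inRange i))
        (block-odd j (prod-positive inRange (s≤s z≤n)))

prod-doubledWord : ∀ {m js} → IsWordIn m js → ∀ a → prod (doubledWord js) a ≡ double (prod js) a
prod-doubledWord {js = js} inRange a with halves a
... | even i = trans (prod-doubledWord-even inRange i) (sym (double-even (prod js) i))
... | odd i  = begin
  prod (doubledWord js) (suc (2 * i))   ≡⟨ cong (prod (doubledWord js)) (sym (odd-pred i)) ⟩
  prod (doubledWord js) (2 * suc i ∸ 1) ≡⟨ prod-doubledWord-odd inRange i ⟩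
  2 * prod js (suc i) ∸ 1               ≡⟨ sym (double-odd (prod js) i) ⟩
  double (prod js) (suc (2 * i))        ∎
  where open ≡-Reasoning

-- The potential

occurrences : ℕ → List ℕ → ℕ
occurrences c []       = 0
occurrences c (x ∷ xs) = toℕ (does (x ≟ c)) + occurrences c xs

occurrences-here : ∀ c xs → occurrences c (c ∷ xs) ≡ suc (occurrences c xs)
occurrences-here c xs rewrite dec-true (c ≟ c) refl = refl

occurrences-there : ∀ {c x} xs → x ≢ c → occurrences c (x ∷ xs) ≡ occurrences c xs
occurrences-there {c} {x} xs x≢c rewrite dec-false (x ≟ c) x≢c = refl

occurrences-absent : ∀ {c xs} → All (_≢ c) xs → occurrences c xs ≡ 0
occurrences-absent []                 = refl
occurrences-absent {xs = _ ∷ xs} (x≢c ∷ absent) = trans (occurrences-there xs x≢c) (occurrences-absent absent)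

occurrences-unique : ∀ c {xs} → Unique xs → occurrences c xs ≤ 1
occurrences-unique c []                    = z≤n
occurrences-unique c {x ∷ xs} (x∉xs ∷ unique) with x ≟ c
... | yes refl rewrite occurrences-here x xs = s≤s (≤-reflexive (occurrences-absent (All.map (_∘ sym) x∉xs)))
... | no x≢c   rewrite occurrences-there xs x≢c = occurrences-unique c unique

m∸n≡1+m∸[1+n] : ∀ {m n} → n < m → m ∸ n ≡ suc (m ∸ suc n)
m∸n≡1+m∸[1+n] {suc m} {zero}  _         = refl
m∸n≡1+m∸[1+n] {suc m} {suc n} (s≤s n<m) = m∸n≡1+m∸[1+n] n<m

weighted-sum : ∀ {n u v D E sk X Y oL oR cL cR} → n ≡ suc (u + v) →
  D + sk ≤ E + X + Y → D + cR * oR ≤ E + X + cR * Y → D + cL * oL ≤ E + Y + cL * X →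
  n * D + sk + (cR * (u * oR) + cL * (v * oL)) ≤ n * E + (suc u * X + suc v * Y) + (cR * (u * Y) + cL * (v * X))
weighted-sum {_} {u} {v} {D} {E} {sk} {X} {Y} {oL} {oR} {cL} {cR} refl bound right left = begin
  suc (u + v) * D + sk + (cR * (u * oR) + cL * (v * oL))
    ≡⟨ solve 8 (λ u v D sk oL oR cL cR →
         (con 1 :+ (u :+ v)) :* D :+ sk :+ (cR :* (u :* oR) :+ cL :* (v :* oL)) :=
         (D :+ sk) :+ u :* (D :+ cR :* oR) :+ v :* (D :+ cL :* oL)) refl u v D sk oL oR cL cR ⟩
  (D + sk) + u * (D + cR * oR) + v * (D + cL * oL)
    ≤⟨ +-mono-≤ (+-mono-≤ bound (*-monoʳ-≤ u right)) (*-monoʳ-≤ v left) ⟩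
  (E + X + Y) + u * (E + X + cR * Y) + v * (E + Y + cL * X)
    ≡⟨ solve 7 (λ u v E X Y cL cR →
         (E :+ X :+ Y) :+ u :* (E :+ X :+ cR :* Y) :+ v :* (E :+ Y :+ cL :* X) :=
         (con 1 :+ (u :+ v)) :* E :+ ((con 1 :+ u) :* X :+ (con 1 :+ v) :* Y) :+ (cR :* (u :* Y) :+ cL :* (v :* X)))
         refl u v E X Y cL cR ⟩
  suc (u + v) * E + (suc u * X + suc v * Y) + (cR * (u * Y) + cL * (v * X)) ∎
  where
  open ≤-Reasoning
  open +-*-Solver

combine-bounds : ∀ {n D E sk In A B Dr Er skr Φ Φ′} →
  n * D + sk + A ≤ n * E + In + B → n * Dr + skr ≤ n * Er + Φ′ → Φ′ + B ≡ Φ + A →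
  n * (D + Dr) + (sk + skr) ≤ n * (E + Er) + (In + Φ)
combine-bounds {n} {D} {E} {sk} {In} {A} {B} {Dr} {Er} {skr} {Φ} {Φ′} block rest transfer =
  +-cancelʳ-≤ A _ _ (begin
    n * (D + Dr) + (sk + skr) + A
      ≡⟨ solve 6 (λ n D sk A Dr skr →
           n :* (D :+ Dr) :+ (sk :+ skr) :+ A := (n :* D :+ sk :+ A) :+ (n :* Dr :+ skr)) refl n D sk A Dr skr ⟩
    (n * D + sk + A) + (n * Dr + skr)
      ≤⟨ +-mono-≤ block rest ⟩
    (n * E + In + B) + (n * Er + Φ′)
      ≡⟨ solve 6 (λ n E In B Er Φ′ →
           (n :* E :+ In :+ B) :+ (n :* Er :+ Φ′) := (n :* E :+ In :+ n :* Er) :+ (Φ′ :+ B))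
           refl n E In B Er Φ′ ⟩
    (n * E + In + n * Er) + (Φ′ + B)
      ≡⟨ cong (n * E + In + n * Er +_) transfer ⟩
    (n * E + In + n * Er) + (Φ + A)
      ≡⟨ solve 6 (λ n E In Er Φ A →
           (n :* E :+ In :+ n :* Er) :+ (Φ :+ A) := n :* (E :+ Er) :+ (In :+ Φ) :+ A) refl n E In Er Φ A ⟩
    n * (E + Er) + (In + Φ) + A ∎)
  where
  open ≤-Reasoning
  open +-*-Solver

exchange-second : ∀ a b b′ F F′ c c′ r r′ → F′ + (r + c) ≡ F + (r′ + c′) →
  a + b′ + F′ + (r + (b + c)) ≡ a + b + F + (r′ + (b′ + c′))
exchange-second a b b′ F F′ c c′ r r′ eq = begin
  a + b′ + F′ + (r + (b + c))
    ≡⟨ solve 6 (λ a b b′ F′ c r →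
         a :+ b′ :+ F′ :+ (r :+ (b :+ c)) := a :+ b′ :+ b :+ (F′ :+ (r :+ c))) refl a b b′ F′ c r ⟩
  a + b′ + b + (F′ + (r + c))
    ≡⟨ cong (a + b′ + b +_) eq ⟩
  a + b′ + b + (F + (r′ + c′))
    ≡⟨ solve 6 (λ a b b′ F c′ r′ →
         a :+ b′ :+ b :+ (F :+ (r′ :+ c′)) := a :+ b :+ F :+ (r′ :+ (b′ :+ c′))) refl a b b′ F c′ r′ ⟩
  a + b + F + (r′ + (b′ + c′)) ∎
  where
  open ≡-Reasoning
  open +-*-Solver

exchange-first : ∀ a b b′ F F′ c c′ r r′ → F′ + (r + c) ≡ F + (r′ + c′) →
  b′ + a + F′ + ((b + r) + c) ≡ b + a + F + ((b′ + r′) + c′)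
exchange-first a b b′ F F′ c c′ r r′ eq = begin
  b′ + a + F′ + ((b + r) + c)
    ≡⟨ solve 6 (λ a b b′ F′ c r →
         b′ :+ a :+ F′ :+ ((b :+ r) :+ c) := b′ :+ a :+ b :+ (F′ :+ (r :+ c))) refl a b b′ F′ c r ⟩
  b′ + a + b + (F′ + (r + c))
    ≡⟨ cong (b′ + a + b +_) eq ⟩
  b′ + a + b + (F + (r′ + c′))
    ≡⟨ solve 6 (λ a b b′ F c′ r′ →
         b′ :+ a :+ b :+ (F :+ (r′ :+ c′)) := b :+ a :+ F :+ ((b′ :+ r′) :+ c′)) refl a b b′ F c′ r′ ⟩
  b + a + F + ((b′ + r′) + c′) ∎
  where
  open ≡-Reasoning
  open +-*-Solver

module Potential (n : ℕ) where

  Φ : (ℕ → ℕ) → List ℕ → ℕ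
  Φ ι []       = 0
  Φ ι (j ∷ js) = (n ∸ j) * ι j + suc j * ι (suc j) + Φ ι js

  private
    m≢m+1 : ∀ m → m ≢ suc m
    m≢m+1 m = <⇒≢ (n<1+n m)

    m≢m+2 : ∀ m → m ≢ suc (suc m)
    m≢m+2 m = <⇒≢ (m<n⇒m<1+n (n<1+n m))

  Φ-update : ∀ m {ι ι′} rs → All (_≢ suc m) rs →
    (∀ i → i ≢ suc m → i ≢ suc (suc m) → ι′ i ≡ ι i) →
    let u = n ∸ suc (suc m); cR = occurrences (suc (suc m)) rs; cL = occurrences m rs in
    Φ ι′ rs + (cR * (u * ι (suc (suc m))) + cL * (suc m * ι (suc m)))
      ≡ Φ ι rs + (cR * (u * ι′ (suc (suc m))) + cL * (suc m * ι′ (suc m)))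
  Φ-update m []       []              agree = refl
  Φ-update m {ι} {ι′} (j ∷ rs) (j≢m+1 ∷ absent) agree with j ≟ m
  ... | yes refl
    rewrite occurrences-here j rs | occurrences-there rs (m≢m+2 j) | agree j (m≢m+1 j) (m≢m+2 j) =
    exchange-second ((n ∸ j) * ι j) (suc j * ι (suc j)) (suc j * ι′ (suc j)) (Φ ι rs) (Φ ι′ rs)
      (occurrences j rs * (suc j * ι (suc j))) (occurrences j rs * (suc j * ι′ (suc j)))
      (occurrences (suc (suc j)) rs * ((n ∸ suc (suc j)) * ι (suc (suc j))))
      (occurrences (suc (suc j)) rs * ((n ∸ suc (suc j)) * ι′ (suc (suc j))))
      (Φ-update j rs absent agree)
  ... | no j≢m with j ≟ suc (suc m)
  ...   | yes refl
    rewrite occurrences-there rs j≢m | occurrences-here j rs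
          | agree (suc j) (m≢m+2 (suc m) ∘ sym) (m≢m+1 j ∘ sym) =
    exchange-first (suc j * ι (suc j)) ((n ∸ j) * ι j) ((n ∸ j) * ι′ j) (Φ ι rs) (Φ ι′ rs)
      (occurrences m rs * (suc m * ι (suc m))) (occurrences m rs * (suc m * ι′ (suc m)))
      (occurrences j rs * ((n ∸ j) * ι j)) (occurrences j rs * ((n ∸ j) * ι′ j))
      (Φ-update m rs absent agree)
  ...   | no j≢m+2
    rewrite occurrences-there rs j≢m | occurrences-there rs j≢m+2
          | agree j j≢m+1 j≢m+2 | agree (suc j) (j≢m ∘ suc-injective) (j≢m+1 ∘ suc-injective) =
    trans (+-assoc head (Φ ι′ rs) _)
          (trans (cong (head +_) (Φ-update m rs absent agree)) (sym (+-assoc head (Φ ι rs) _)))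
    where head = (n ∸ j) * ι j + suc j * ι (suc j)

  block-balance : ∀ {m y} → suc m < n → PreservesCut y (2 * suc m) → Injective y →
    ∀ {cL cR} → cL ≤ 1 → cR ≤ 1 → (bs : Vec Bool 4) →
    let P = 2 * suc m ∸ 1; y′ = after y (block P) (toList bs); u = n ∸ suc (suc m) in
    n * skipped (λ d → d) y (block P) (toList bs) + someSkipped (toList bs)
      + (cR * (u * pairInversion y′ (suc (suc m))) + cL * (suc m * pairInversion y′ (suc m)))
    ≤ n * skipped not y (block P) (toList bs)
      + ((n ∸ suc m) * pairInversion y (suc m) + suc (suc m) * pairInversion y (suc (suc m)))
      + (cR * (u * pairInversion y (suc (suc m))) + cL * (suc m * pairInversion y (suc m)))
  block-balance {m} {y} j<n cut inj {cL} {cR} cL≤1 cR≤1 bs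
    rewrite skipped-block (λ d → d) cut inj (toList bs) | skipped-block not cut inj (toList bs)
          | block-left-output m cut inj (toList bs) | block-right-output m cut inj (toList bs)
          | pairInversion-right y m | m∸n≡1+m∸[1+n] j<n =
    weighted-sum {n} {n ∸ suc (suc m)} {suc m} {cL = cL} {cR} n≡
      (model-bound X Y bs) (model-right X Y cR≤1 bs) (model-left X Y cL≤1 bs)
    where
    X = descent y (2 * suc m ∸ 1)
    Y = descent y (2 + (2 * suc m ∸ 1))
    n≡ : n ≡ suc (n ∸ suc (suc m) + suc m)
    n≡ = sym (trans (cong suc (+-comm (n ∸ suc (suc m)) (suc m))) (m+[n∸m]≡n j<n))

  skippingBlocks : (js : List ℕ) → Vec Bool (length (doubledWord js)) → ℕ
  skippingBlocks []       []                      = 0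
  skippingBlocks (_ ∷ js) (b₁ ∷ b₂ ∷ b₃ ∷ b₄ ∷ x) =
    someSkipped (b₁ ∷ b₂ ∷ b₃ ∷ b₄ ∷ []) + skippingBlocks js x

  potential-bound : ∀ {js} → IsWordIn n js → Unique js → ∀ {y} → Injective y →
    All (λ j → PreservesCut y (2 * j)) js → (x : Vec Bool (length (doubledWord js))) →
    n * skipped (λ d → d) y (doubledWord js) (toList x) + skippingBlocks js x
      ≤ n * skipped not y (doubledWord js) (toList x) + Φ (pairInversion y) js
  potential-bound [] [] inj [] [] = ≤-refl
  potential-bound {suc m ∷ js} ((_ , j<n) ∷ inRange) (j∉js ∷ unique) {y} inj (cut ∷ cuts)
                  (b₁ ∷ b₂ ∷ b₃ ∷ b₄ ∷ x) =
    subst₂ (λ D E → n * D + (someSkipped bs + skippingBlocks js x) ≤ n * E + (head + Φ ι js))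
      (sym (skipped-++ (λ d → d) y (block P) {doubledWord js} bs {toList x} refl))
      (sym (skipped-++ not y (block P) {doubledWord js} bs {toList x} refl))
      (combine-bounds {n} {D = skipped (λ d → d) y (block P) bs} {E = skipped not y (block P) bs} {In = head}
               {A = cR * (u * ι′ (suc (suc m))) + cL * (suc m * ι′ (suc m))}
               {B = cR * (u * ι (suc (suc m))) + cL * (suc m * ι (suc m))}
               {Dr = skipped (λ d → d) y′ (doubledWord js) (toList x)}
               {Er = skipped not y′ (doubledWord js) (toList x)}
               {Φ = Φ ι js} {Φ′ = Φ ι′ js}
        (block-balance j<n cut inj (occurrences-unique m unique) (occurrences-unique (suc (suc m)) unique)
                       (b₁ ∷ b₂ ∷ b₃ ∷ b₄ ∷ []))
        (potential-bound inRange unique (block-injective P bs inj) (block-preservesCuts m bs j∉js cuts) x)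
        (Φ-update m js (All.map (_∘ sym) j∉js) (λ i → pairInversion-outside m y bs)))
    where
    P = 2 * suc m ∸ 1
    bs = b₁ ∷ b₂ ∷ b₃ ∷ b₄ ∷ []
    y′ = after y (block P) bs
    ι = pairInversion y
    ι′ = pairInversion y′
    u = n ∸ suc (suc m)
    cL = occurrences m js
    cR = occurrences (suc (suc m)) js
    head = (n ∸ suc m) * ι (suc m) + suc (suc m) * ι (suc (suc m))

  Φ-vanishes : ∀ {ι} → (∀ i → ι i ≡ 0) → ∀ js → Φ ι js ≡ 0
  Φ-vanishes ι≡0 []       = refl
  Φ-vanishes ι≡0 (j ∷ js) rewrite ι≡0 j | ι≡0 (suc j) | *-zeroʳ (n ∸ j) | *-zeroʳ j =
    Φ-vanishes ι≡0 js

  skippingBlocks-nonFull : ∀ js (x : Vec Bool (length (doubledWord js))) → NonFull x → 1 ≤ skippingBlocks js x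
  skippingBlocks-nonFull []       []                              nonFull = ⊥-elim (nonFull refl)
  skippingBlocks-nonFull (_ ∷ js) (true ∷ true ∷ true ∷ true ∷ x) nonFull =
    skippingBlocks-nonFull js x (nonFull ∘ cong (λ x → true ∷ true ∷ true ∷ true ∷ x))
  skippingBlocks-nonFull (_ ∷ _)  (false ∷ _ ∷ _ ∷ _ ∷ _)         _ = s≤s z≤n
  skippingBlocks-nonFull (_ ∷ _)  (true ∷ false ∷ _ ∷ _ ∷ _)      _ = s≤s z≤n
  skippingBlocks-nonFull (_ ∷ _)  (true ∷ true ∷ false ∷ _ ∷ _)   _ = s≤s z≤n
  skippingBlocks-nonFull (_ ∷ _)  (true ∷ true ∷ true ∷ false ∷ _) _ = s≤s z≤n

pairInversion-id : ∀ i → pairInversion (λ a → a) i ≡ 0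
pairInversion-id i = cong toℕ (<ᵇ-false (m∸n≤m (2 * i) 1))

id-injective : Injective (λ a → a)
id-injective eq = eq

id-preservesCuts : ∀ js → All (λ j → PreservesCut (λ a → a) (2 * j)) js
id-preservesCuts = All.universal (λ j a → (λ a≤2j → a≤2j) , (λ 2j<a → 2j<a))

D0<E0 : ∀ {n js} → IsWordIn n js → Unique js →
  (x : Vec Bool (length (doubledWord js))) → NonFull x → D0 (doubledWord js) x < E0 (doubledWord js) x
D0<E0 {n} {js} inRange unique x nonFull = *-cancelˡ-< n _ _ (begin-strict
  n * D0 w x
    <⟨ m<m+n _ (skippingBlocks-nonFull js x nonFull) ⟩
  n * D0 w x + skippingBlocks js x
    ≤⟨ potential-bound inRange unique id-injective (id-preservesCuts js) x ⟩
  n * E0 w x + Φ (pairInversion (λ a → a)) js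
    ≡⟨ cong (n * E0 w x +_) (Φ-vanishes pairInversion-id js) ⟩
  n * E0 w x + 0
    ≡⟨ +-identityʳ _ ⟩
  n * E0 w x ∎)
  where
  open Potential n
  open ≤-Reasoning
  w = doubledWord js

-- Reducedness

allOnes-ascends : ∀ {n js} → IsWordIn n js → Unique js → ∀ {y} → Injective y →
  All (λ j → PreservesCut y (2 * j)) js → (∀ i → pairInversion y i ≡ 0) →
  All (_≡ false) (defectFlags y (doubledWord js) (allOnes (doubledWord js)))
allOnes-ascends [] [] inj [] uninverted = []
allOnes-ascends {js = suc m ∷ js} (_ ∷ inRange) (j∉js ∷ unique) {y} inj (cut ∷ cuts) uninverted =
  All.++⁺ block-ascends
    (allOnes-ascends inRange unique (block-injective P ones inj) (block-preservesCuts m ones j∉js cuts)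
                     uninverted′)
  where
  P = 2 * suc m ∸ 1
  ones = true ∷ true ∷ true ∷ true ∷ []
  X≡false : descent y P ≡ false
  X≡false = toℕ≡0 (uninverted (suc m))
  Y≡false : descent y (2 + P) ≡ false
  Y≡false = toℕ≡0 (trans (sym (pairInversion-right y m)) (uninverted (suc (suc m))))
  unchanged : ranks (descent y P) (descent y (2 + P)) ≡ ranks false false
  unchanged = cong₂ ranks X≡false Y≡false
  block-ascends : All (_≡ false) (defectFlags y (block P) ones)
  block-ascends = subst (All (_≡ false)) (sym (trans (block-flags cut inj ones)
    (cong (λ ρ → defectFlags ρ modelWord ones) unchanged))) (refl ∷ refl ∷ refl ∷ refl ∷ [])
  uninverted′ : ∀ i → pairInversion (after y (block P) ones) i ≡ 0
  uninverted′ i with i ≟ suc m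
  ... | yes refl =
    trans (block-left-output m cut inj ones) (cong (λ ρ → toℕ (descent (after ρ modelWord ones) 0)) unchanged)
  ... | no i≢j with i ≟ suc (suc m)
  ...   | yes refl =
    trans (block-right-output m cut inj ones) (cong (λ ρ → toℕ (descent (after ρ modelWord ones) 2)) unchanged)
  ...   | no i≢j+1 = trans (pairInversion-outside m y ones i≢j i≢j+1) (uninverted i)

doubledWord-inRange : ∀ {n js} → IsWordIn n js → IsWordIn (2 * n) (doubledWord js)
doubledWord-inRange []                                   = []
doubledWord-inRange {n} {suc m ∷ js} ((_ , j<n) ∷ inRange) =
  (s≤s z≤n , 1+P<2n) ∷ (1≤P , <-trans (n<1+n P) 1+P<2n) ∷ (s≤s z≤n , 2+P<2n) ∷ (s≤s z≤n , 1+P<2n) ∷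
    doubledWord-inRange inRange
  where
  P = 2 * suc m ∸ 1
  2+P<2n : 2 + P < 2 * n
  2+P<2n = subst (_≤ 2 * n) (*-suc 2 (suc m)) (*-monoʳ-≤ 2 j<n)
  1+P<2n : 1 + P < 2 * n
  1+P<2n = <-trans (n<1+n (1 + P)) 2+P<2n
  1≤P : 1 ≤ P
  1≤P = subst (1 ≤_) (sym (odd-pred m)) (s≤s z≤n)

doubledWord-reduced : ∀ {n js} → IsWordIn n js → Unique js →
  length (doubledWord js) ≡ inversions (2 * n) (prod (doubledWord js))
doubledWord-reduced {n} {js} inRange unique = sym (begin
  inversions (2 * n) (prod w)
    ≡⟨ inversions-cong (2 * n) (λ a → sym (after-allOnes w (λ b → b) a)) ⟩
  inversions (2 * n) (after (λ b → b) w (allOnes w))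
    ≡⟨ inversions-ascending (λ b → b) (doubledWord-inRange inRange) id-injective
         (allOnes-ascends inRange unique id-injective (id-preservesCuts js) pairInversion-id) ⟩
  length w + inversions (2 * n) (λ b → b)
    ≡⟨ cong (length w +_) (inversions-id (2 * n)) ⟩
  length w + 0
    ≡⟨ +-identityʳ (length w) ⟩
  length w ∎)
  where
  open ≡-Reasoning
  w = doubledWord js

corollary4p5 : (n : ℕ) (js : List ℕ) → IsWordIn n js → Unique js →
    Tight (2 * n) (double (prod js))
    × ((x : Vec Bool (length (doubledWord js))) → NonFull x →
         D0 (doubledWord js) x < E0 (doubledWord js) x)
corollary4p5 n js inRange unique =
  (doubledWord js , (doubledWord-inRange inRange , prod-doubledWord inRange , doubledWord-reduced inRange unique) ,
   D0<E0 inRange unique) ,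
  D0<E0 inRange unique
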